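{- For every positive integer $n$: - if $n\equiv 1\pmod 4$, then $t(1,4,7;n)=2N(1,4,7;2n+3)$; - if $n\equiv 3\pmod 4$, then $t(1,7,12;n)=2N(1,7,12;2n+5)$; - if $n\equiv 1\pmod 4$, then $t(1,7,28;n)=2N(1,7,28;2n+9)$; - if $n\equiv 1\pmod 4$, then $t(3,4,21;n)=2N(3,4,21;2n+7)$; - if $n\equiv 1\pmod 4$, then $t(3,21,28;n)=2N(3,21,28;2n+13)$.
   Context: For positive integers $a,b,c$ and $n\in\mathbb{N}=\{0,1,2,\dots\}$, $N(a,b,c;n)$ denotes the number of triples $(x,y,z)\in\mathbb{Z}^3$ with $n=ax^2+by^2+cz^2$, and $t(a,b,c;n)$ denotes the number of triples $(x,y,z)\in\mathbb{Z}^3$ with $n=a\frac{x(x+1)}2+b\frac{y(y+1)}2+c\frac{z(z+1)}2$. -}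

module Defs where

open import Data.Nat using (ℕ; zero; suc) renaming (_+_ to _+ℕ_; _*_ to _*ℕ_)
open import Data.Integer using (ℤ; +_; -[1+_]; _+_; _*_; _-_)
open import Data.Integer.Properties using () renaming (_≟_ to _≟ℤ_)
open import Data.List using (List; []; _∷_; length; filter; map; concatMap; upTo)
open import Data.Product using (_×_; _,_)
open import Relation.Nullary.Decidable using (does)
open import Data.Bool using (Bool; T?)

intRange : ℕ → List ℤ
intRange B = map (λ k → + k) (upTo (suc B)) Data.List.++ map (λ k → -[1+ k ]) (upTo B)

triples : ℕ → List (ℤ × ℤ × ℤ)
triples B = concatMap (λ x → concatMap (λ y → map (λ z → (x , y , z)) (intRange B)) (intRange B)) (intRange B)

countIn : ℕ → (ℤ × ℤ × ℤ → Bool) → ℕ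
countIn B p = length (filter (λ t → T? (p t)) (triples B))

-- N(a,b,c;n) = #{(x,y,z) ∈ ℤ³ : n = a x² + b y² + c z²}.
-- For a,b,c ≥ 1 every solution has |x|,|y|,|z| ≤ n, so counting inside [-n,n]³
-- counts all of ℤ³.
N : ℕ → ℕ → ℕ → ℕ → ℕ
N a b c n = countIn n (λ { (x , y , z) →
  does ((+ a) * (x * x) + (+ b) * (y * y) + (+ c) * (z * z) ≟ℤ + n) })

-- t(a,b,c;n) = #{(x,y,z) ∈ ℤ³ : n = a x(x+1)/2 + b y(y+1)/2 + c z(z+1)/2},
-- written without division as 2n = a x(x+1) + b y(y+1) + c z(z+1).
-- For a,b,c ≥ 1 every solution has x(x+1)/2 ≤ n, hence -n-1 ≤ x ≤ n, so
-- counting inside [-(n+1), n+1]³ counts all of ℤ³.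
t : ℕ → ℕ → ℕ → ℕ → ℕ
t a b c n = countIn (suc n) (λ { (x , y , z) →
  does ((+ a) * (x * (x + + 1)) + (+ b) * (y * (y + + 1)) + (+ c) * (z * (z + + 1)) ≟ℤ + (2 *ℕ n)) })

{-# OPTIONS --safe #-}
-- Let Q = ax² + by² + cz² with a + b + c = 4k and M = 4(2n + k). Since
-- Q(2v + 1) = 4(ax(x+1) + by(y+1) + cz(z+1)) + 4k, the map v ↦ 2v + 1 identifies the triples counted by
-- t(a,b,c;n) with the solutions of Q(v) = M whose coordinates are all odd, and v ↦ 2v identifies those
-- counted by N(a,b,c;2n+k) with the solutions whose coordinates are all even. For each form, a linear
-- congruence splits a class of solutions into two halves, each mapped bijectively onto the even
-- solutions by a rational similitude v ↦ Lv/d of Q (LᵀQL = d²Q) with inverse w ↦ L′w/e (L′L = de·I).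
-- For (1,4,7) and (1,7,28) that class consists of the odd solutions; for the other three forms it is an
-- intermediate class onto which the odd solutions are mapped half by half in the same way. Given M mod 32,
-- whether such a map is integral on a class and lands in the target class depends only on v mod 32, so it
-- is decided by evaluation over (ℤ/32)³.
module Submission where

open import Defs

-- A local scope for ℤ arithmetic: the theorem at the end is stated with ℕ's _+_ and _*_.
module _ where
  open import Algebra.Bundles using (AbelianGroup)
  open import Data.Bool using (Bool; true; false; _∧_; _∨_; not; T)
  open import Data.Bool.ListAction using (all)
  import Data.Bool.Properties as Bool
  open import Data.Empty using (⊥)
  open import Data.Integer using (ℤ; +_; -[1+_]; _+_; _*_; _-_; -_; ∣_∣; _/ℕ_; _%ℕ_)
  open import Data.Integer.Divisibility.Signed
    using (_∣_; divides; _∣?_; ∣ᵤ⇒∣; ∣⇒∣ᵤ; ∣-trans; ∣m⇒∣-m; ∣m∣n⇒∣m+n; ∣n⇒∣m*n; ∣m⇒∣m*n; *-monoʳ-∣; *-cancelˡ-∣)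
  open import Data.Integer.DivMod using (a≡a%ℕn+[a/ℕn]*n; n%ℕd<d)
  import Data.Integer.Properties as ℤ
  open import Data.Integer.Properties using (_≟_)
  open import Data.Integer.Tactic.RingSolver using (solve-∀)
  open import Algebra.Properties.Group (AbelianGroup.group ℤ.+-0-abelianGroup)
    using () renaming (∙-cancelʳ to +-cancelʳ)
  open import Data.List
    using (List; []; _∷_; _++_; map; upTo; length; filter; concatMap; cartesianProduct; cartesianProductWith)
  import Data.List.Properties as List
  open import Data.List.Membership.Propositional using (_∈_)
  open import Data.List.Membership.Propositional.Properties
    using (∈-map⁺; ∈-map⁻; ∈-upTo⁺; ∈-cartesianProduct⁺; ∈-++⁺ˡ; ∈-++⁺ʳ; ∈-filter⁺; ∈-filter⁻)
  open import Data.List.Membership.Propositional.Properties.WithK using (unique∧set⇒bag)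
  open import Data.List.Relation.Binary.BagAndSetEquality using (∼bag⇒↭)
  open import Data.List.Relation.Binary.Permutation.Propositional.Properties using (↭-length)
  open import Data.List.Relation.Unary.All as All using (All)
  import Data.List.Relation.Unary.All.Properties as All
  open import Data.List.Relation.Unary.Unique.Propositional using (Unique)
  import Data.List.Relation.Unary.Unique.Propositional.Properties as Unique
  open import Data.Nat as ℕ using (ℕ; zero; suc; NonZero; z≤n; s≤s)
  import Data.Nat.DivMod as ℕ
  import Data.Nat.Divisibility as ℕ
  import Data.Nat.Properties as ℕ
  import Data.Nat.Tactic.RingSolver as ℕ-Solver
  open import Data.Product using (_×_; _,_; proj₁; proj₂)
  open import Function.Base using (_∘_)
  open import Function.Bundles using (_⇔_; mk⇔; Equivalence)
  open import Relation.Binary.PropositionalEquality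
  open import Relation.Nullary using (Dec; does; yes)
  import Relation.Nullary.Decidable as Dec
  open import Relation.Nullary.Decidable using (does-⇔; dec-true; T?)

  -- Vectors, matrices and quadratic forms

  ℤ³ : Set
  ℤ³ = ℤ × ℤ × ℤ

  Mat : Set
  Mat = ℤ³ × ℤ³ × ℤ³

  infixr 7 _⊙_
  infix 7 _·_
  infixr 6 _⊛_
  infixl 7 _∙_
  infixr 7 _•_

  _⊙_ : ℤ → ℤ³ → ℤ³
  k ⊙ (x , y , z) = k * x , k * y , k * z

  _·_ : ℤ³ → ℤ³ → ℤ
  (a , b , c) · (x , y , z) = a * x + b * y + c * z

  _⊛_ : Mat → ℤ³ → ℤ³
  (r , s , t) ⊛ v = r · v , s · v , t · v

  _ᵀ : Mat → Mat
  ((a , b , c) , (d , e , f) , (g , h , i)) ᵀ = (a , d , g) , (b , e , h) , (c , f , i)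

  _∙_ : Mat → Mat → Mat
  (r , s , t) ∙ B = B ᵀ ⊛ r , B ᵀ ⊛ s , B ᵀ ⊛ t

  _•_ : ℤ → Mat → Mat
  k • (r , s , t) = k ⊙ r , k ⊙ s , k ⊙ t

  diag : ℕ → ℕ → ℕ → Mat
  diag a b c = (+ a , + 0 , + 0) , (+ 0 , + b , + 0) , (+ 0 , + 0 , + c)

  I : Mat
  I = diag 1 1 1

  triple-≡ : ∀ {x x′ y y′ z z′ : ℤ} → x ≡ x′ → y ≡ y′ → z ≡ z′ → (x , y , z) ≡ (x′ , y′ , z′)
  triple-≡ refl refl refl = refl

  ·-⊛ : ∀ u A v → u · (A ⊛ v) ≡ (A ᵀ ⊛ u) · v
  ·-⊛ (u₁ , u₂ , u₃) ((a , b , c) , (d , e , f) , (g , h , i)) (x , y , z) =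
    adjoint u₁ u₂ u₃ a b c d e f g h i x y z
    where
    adjoint : ∀ u₁ u₂ u₃ a b c d e f g h i x y z →
      u₁ * (a * x + b * y + c * z) + u₂ * (d * x + e * y + f * z) + u₃ * (g * x + h * y + i * z)
        ≡ (a * u₁ + d * u₂ + g * u₃) * x + (b * u₁ + e * u₂ + h * u₃) * y + (c * u₁ + f * u₂ + i * u₃) * z
    adjoint = solve-∀

  ·-⊙ : ∀ k u v → (k ⊙ u) · v ≡ k * (u · v)
  ·-⊙ k (a , b , c) (x , y , z) = scale k a b c x y z
    where
    scale : ∀ k a b c x y z → k * a * x + k * b * y + k * c * z ≡ k * (a * x + b * y + c * z)
    scale = solve-∀

  ·-comm : ∀ u v → u · v ≡ v · u
  ·-comm (a , b , c) (x , y , z) = comm a b c x y z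
    where
    comm : ∀ a b c x y z → a * x + b * y + c * z ≡ x * a + y * b + z * c
    comm = solve-∀

  ·-⊙ʳ : ∀ k u v → u · (k ⊙ v) ≡ k * (u · v)
  ·-⊙ʳ k u v = trans (·-comm u (k ⊙ v)) (trans (·-⊙ k v u) (cong (k *_) (·-comm v u)))

  ⊛-∙ : ∀ A B v → (A ∙ B) ⊛ v ≡ A ⊛ B ⊛ v
  ⊛-∙ (r , s , t) B v = sym (triple-≡ (·-⊛ r B v) (·-⊛ s B v) (·-⊛ t B v))

  ⊛-⊙ : ∀ k A v → A ⊛ (k ⊙ v) ≡ k ⊙ (A ⊛ v)
  ⊛-⊙ k (r , s , t) v = triple-≡ (·-⊙ʳ k r v) (·-⊙ʳ k s v) (·-⊙ʳ k t v)

  •-⊛ : ∀ k A v → (k • A) ⊛ v ≡ k ⊙ (A ⊛ v)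
  •-⊛ k (r , s , t) v = triple-≡ (·-⊙ k r v) (·-⊙ k s v) (·-⊙ k t v)

  I-⊛ : ∀ v → I ⊛ v ≡ v
  I-⊛ (x , y , z) = triple-≡ (e₁ x y z) (e₂ x y z) (e₃ x y z)
    where
    e₁ : ∀ x y z → + 1 * x + + 0 * y + + 0 * z ≡ x
    e₁ = solve-∀
    e₂ : ∀ x y z → + 0 * x + + 1 * y + + 0 * z ≡ y
    e₂ = solve-∀
    e₃ : ∀ x y z → + 0 * x + + 0 * y + + 1 * z ≡ z
    e₃ = solve-∀

  ⟦_⟧ : Mat → ℤ³ → ℤ
  ⟦ S ⟧ v = v · (S ⊛ v)

  ⟦diag⟧ : ∀ a b c x y z → ⟦ diag a b c ⟧ (x , y , z) ≡ + a * (x * x) + + b * (y * y) + + c * (z * z)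
  ⟦diag⟧ a b c = expand (+ a) (+ b) (+ c)
    where
    expand : ∀ a b c x y z →
      x * (a * x + + 0 * y + + 0 * z) + y * (+ 0 * x + b * y + + 0 * z) + z * (+ 0 * x + + 0 * y + c * z)
        ≡ a * (x * x) + b * (y * y) + c * (z * z)
    expand = solve-∀

  ⟦⟧-pullback : ∀ S L v → ⟦ L ᵀ ∙ S ∙ L ⟧ v ≡ ⟦ S ⟧ (L ⊛ v)
  ⟦⟧-pullback S L v = begin
    v · ((L ᵀ ∙ S ∙ L) ⊛ v)      ≡⟨ cong (v ·_) (⊛-∙ (L ᵀ ∙ S) L v) ⟩
    v · ((L ᵀ ∙ S) ⊛ L ⊛ v)      ≡⟨ cong (v ·_) (⊛-∙ (L ᵀ) S (L ⊛ v)) ⟩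
    v · (L ᵀ ⊛ S ⊛ L ⊛ v)        ≡⟨ ·-⊛ v (L ᵀ) (S ⊛ L ⊛ v) ⟩
    (L ⊛ v) · (S ⊛ L ⊛ v)        ∎
    where open ≡-Reasoning

  ⟦⟧-• : ∀ k S v → ⟦ k • S ⟧ v ≡ k * ⟦ S ⟧ v
  ⟦⟧-• k S v = trans (cong (v ·_) (•-⊛ k S v)) (·-⊙ʳ k v (S ⊛ v))

  ⟦⟧-⊙ : ∀ k S v → ⟦ S ⟧ (k ⊙ v) ≡ k * k * ⟦ S ⟧ v
  ⟦⟧-⊙ k S v = begin
    (k ⊙ v) · (S ⊛ k ⊙ v)       ≡⟨ cong ((k ⊙ v) ·_) (⊛-⊙ k S v) ⟩
    (k ⊙ v) · (k ⊙ (S ⊛ v))     ≡⟨ ·-⊙ʳ k (k ⊙ v) (S ⊛ v) ⟩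
    k * ((k ⊙ v) · (S ⊛ v))     ≡⟨ cong (k *_) (·-⊙ k v (S ⊛ v)) ⟩
    k * (k * ⟦ S ⟧ v)           ≡⟨ ℤ.*-assoc k k (⟦ S ⟧ v) ⟨
    k * k * ⟦ S ⟧ v             ∎
    where open ≡-Reasoning

  -- Congruences

  infix 4 _≡_[mod_] _≡?_[mod_] _≡³_[mod_]

  record _≡_[mod_] (a b : ℤ) (m : ℕ) : Set where
    constructor mod
    field
      divides-difference : + m ∣ a - b

  _≡?_[mod_] : ∀ a b m → Dec (a ≡ b [mod m ])
  a ≡? b [mod m ] = Dec.map′ mod _≡_[mod_].divides-difference (+ m ∣? a - b)

  module _ {m : ℕ} where

    mod-refl : ∀ a → a ≡ a [mod m ]
    mod-refl a = mod (divides (+ 0) (trans (ℤ.+-inverseʳ a) (sym (ℤ.*-zeroˡ (+ m)))))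

    mod-sym : ∀ {a b} → a ≡ b [mod m ] → b ≡ a [mod m ]
    mod-sym {a} {b} (mod m∣a-b) = mod (subst (+ m ∣_) (negate a b) (∣m⇒∣-m m∣a-b))
      where
      negate : ∀ a b → - (a - b) ≡ b - a
      negate = solve-∀

    mod-trans : ∀ {a b c} → a ≡ b [mod m ] → b ≡ c [mod m ] → a ≡ c [mod m ]
    mod-trans {a} {b} {c} (mod m∣a-b) (mod m∣b-c) =
      mod (subst (+ m ∣_) (ℤ.+-minus-telescope a b c) (∣m∣n⇒∣m+n m∣a-b m∣b-c))

    mod-+ : ∀ {a b c d} → a ≡ b [mod m ] → c ≡ d [mod m ] → a + c ≡ b + d [mod m ]
    mod-+ {a} {b} {c} {d} (mod m∣a-b) (mod m∣c-d) =
      mod (subst (+ m ∣_) (regroup a b c d) (∣m∣n⇒∣m+n m∣a-b m∣c-d))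
      where
      regroup : ∀ a b c d → (a - b) + (c - d) ≡ (a + c) - (b + d)
      regroup = solve-∀

    mod-* : ∀ {a b c d} → a ≡ b [mod m ] → c ≡ d [mod m ] → a * c ≡ b * d [mod m ]
    mod-* {a} {b} {c} {d} (mod m∣a-b) (mod m∣c-d) =
      mod (subst (+ m ∣_) (regroup a b c d) (∣m∣n⇒∣m+n (∣n⇒∣m*n a m∣c-d) (∣m⇒∣m*n d m∣a-b)))
      where
      regroup : ∀ a b c d → a * (c - d) + (a - b) * d ≡ a * c - b * d
      regroup = solve-∀

  mod-weaken : ∀ {m k a b} → m ℕ.∣ k → a ≡ b [mod k ] → a ≡ b [mod m ]
  mod-weaken m∣k (mod k∣a-b) = mod (∣-trans (∣ᵤ⇒∣ m∣k) k∣a-b)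

  mod-*-cancel : ∀ d m {a b} .⦃ _ : NonZero d ⦄ → (+ d * a ≡ + d * b [mod d ℕ.* m ]) ⇔ (a ≡ b [mod m ])
  mod-*-cancel d m {a} {b} = mk⇔
    (λ (mod h) → mod (*-cancelˡ-∣ (+ d) (subst₂ _∣_ (ℤ.pos-* d m) (factor (+ d) a b) h)))
    (λ (mod h) → mod (subst₂ _∣_ (sym (ℤ.pos-* d m)) (sym (factor (+ d) a b)) (*-monoʳ-∣ (+ d) h)))
    where
    factor : ∀ d a b → d * a - d * b ≡ d * (a - b)
    factor = solve-∀

  [a+b]-a≡b : ∀ a b → a + b - a ≡ b
  [a+b]-a≡b = solve-∀

  ≡-%ℕ : ∀ a K .⦃ _ : NonZero K ⦄ → a ≡ + (a %ℕ K) [mod K ]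
  ≡-%ℕ a K = mod (divides (a /ℕ K)
    (trans (cong (_- + (a %ℕ K)) (a≡a%ℕn+[a/ℕn]*n a K)) ([a+b]-a≡b (+ (a %ℕ K)) (a /ℕ K * + K))))

  data _≡³_[mod_] : ℤ³ → ℤ³ → ℕ → Set where
    mod³ : ∀ {m x y z x′ y′ z′} → x ≡ x′ [mod m ] → y ≡ y′ [mod m ] → z ≡ z′ [mod m ] →
           (x , y , z) ≡³ (x′ , y′ , z′) [mod m ]

  ≡³-refl : ∀ {m} v → v ≡³ v [mod m ]
  ≡³-refl (x , y , z) = mod³ (mod-refl x) (mod-refl y) (mod-refl z)

  ≡³-sym : ∀ {m u v} → u ≡³ v [mod m ] → v ≡³ u [mod m ]
  ≡³-sym (mod³ p q r) = mod³ (mod-sym p) (mod-sym q) (mod-sym r)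

  ·-mod : ∀ {m u u′ v v′} → u ≡³ u′ [mod m ] → v ≡³ v′ [mod m ] → u · v ≡ u′ · v′ [mod m ]
  ·-mod (mod³ p q r) (mod³ p′ q′ r′) = mod-+ (mod-+ (mod-* p p′) (mod-* q q′)) (mod-* r r′)

  ⊛-mod : ∀ {m v w} A → v ≡³ w [mod m ] → A ⊛ v ≡³ A ⊛ w [mod m ]
  ⊛-mod (r , s , t) v≡w = mod³ (·-mod (≡³-refl r) v≡w) (·-mod (≡³-refl s) v≡w) (·-mod (≡³-refl t) v≡w)

  ⟦⟧-mod : ∀ {m v w} S → v ≡³ w [mod m ] → ⟦ S ⟧ v ≡ ⟦ S ⟧ w [mod m ]
  ⟦⟧-mod S v≡w = ·-mod v≡w (⊛-mod S v≡w)

  residues : ℕ → List ℤ³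
  residues K = cartesianProduct R (cartesianProduct R R)
    where R = map +_ (upTo K)

  residue : (K : ℕ) .⦃ _ : NonZero K ⦄ → ℤ³ → ℤ³
  residue K (x , y , z) = + (x %ℕ K) , + (y %ℕ K) , + (z %ℕ K)

  residue-≡³ : ∀ K .⦃ _ : NonZero K ⦄ v → v ≡³ residue K v [mod K ]
  residue-≡³ K (x , y , z) = mod³ (≡-%ℕ x K) (≡-%ℕ y K) (≡-%ℕ z K)

  residue-∈ : ∀ K .⦃ _ : NonZero K ⦄ v → residue K v ∈ residues K
  residue-∈ K (x , y , z) = ∈-cartesianProduct⁺ (∈ℕ x) (∈-cartesianProduct⁺ (∈ℕ y) (∈ℕ z))
    where
    ∈ℕ : ∀ a → + (a %ℕ K) ∈ map +_ (upTo K)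
    ∈ℕ a = ∈-map⁺ +_ (∈-upTo⁺ (n%ℕd<d a K))

  -- Exact division

  0³ : ℤ³
  0³ = + 0 , + 0 , + 0

  infixl 8 _⊘_
  _⊘_ : ℤ³ → (d : ℕ) .⦃ _ : NonZero d ⦄ → ℤ³
  (x , y , z) ⊘ d = x /ℕ d , y /ℕ d , z /ℕ d

  %ℕ-∣ : ∀ {a} d .⦃ _ : NonZero d ⦄ → + d ∣ a → a %ℕ d ≡ 0
  %ℕ-∣ {+ n} d d∣a = ℕ.n∣m⇒m%n≡0 n d (∣⇒∣ᵤ d∣a)
  %ℕ-∣ { -[1+ n ]} d d∣a rewrite ℕ.n∣m⇒m%n≡0 (suc n) d (∣⇒∣ᵤ d∣a) = refl

  /ℕ-exact : ∀ {a} d .⦃ _ : NonZero d ⦄ → a ≡ + 0 [mod d ] → + d * (a /ℕ d) ≡ a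
  /ℕ-exact {a} d (mod d∣a-0) = begin
    + d * (a /ℕ d)                 ≡⟨ ℤ.*-comm (+ d) (a /ℕ d) ⟩
    a /ℕ d * + d                   ≡⟨ ℤ.+-identityˡ (a /ℕ d * + d) ⟨
    + 0 + a /ℕ d * + d             ≡⟨ cong (λ r → + r + a /ℕ d * + d) (%ℕ-∣ d d∣a) ⟨
    + (a %ℕ d) + a /ℕ d * + d      ≡⟨ a≡a%ℕn+[a/ℕn]*n a d ⟨
    a                              ∎
    where
    open ≡-Reasoning
    d∣a = subst (+ d ∣_) (ℤ.+-identityʳ a) d∣a-0

  multiple-≡0 : ∀ d a → + d * a ≡ + 0 [mod d ]
  multiple-≡0 d a = mod (divides a (trans (ℤ.+-identityʳ (+ d * a)) (ℤ.*-comm (+ d) a)))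

  *-/ℕ : ∀ d .⦃ _ : NonZero d ⦄ a → (+ d * a) /ℕ d ≡ a
  *-/ℕ d a = ℤ.*-cancelˡ-≡ (+ d) _ _ (/ℕ-exact d (multiple-≡0 d a))

  ⊘-exact : ∀ {u} d .⦃ _ : NonZero d ⦄ → u ≡³ 0³ [mod d ] → + d ⊙ u ⊘ d ≡ u
  ⊘-exact d (mod³ x≡0 y≡0 z≡0) = triple-≡ (/ℕ-exact d x≡0) (/ℕ-exact d y≡0) (/ℕ-exact d z≡0)

  ⊙-⊘ : ∀ d .⦃ _ : NonZero d ⦄ u → (+ d ⊙ u) ⊘ d ≡ u
  ⊙-⊘ d (x , y , z) = triple-≡ (*-/ℕ d x) (*-/ℕ d y) (*-/ℕ d z)

  ⊙-≡³0 : ∀ d u → + d ⊙ u ≡³ 0³ [mod d ]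
  ⊙-≡³0 d (x , y , z) = mod³ (multiple-≡0 d x) (multiple-≡0 d y) (multiple-≡0 d z)

  ⊙-cancel : ∀ d .⦃ _ : NonZero d ⦄ {u v} → + d ⊙ u ≡ + d ⊙ v → u ≡ v
  ⊙-cancel d {u} {v} du≡dv = trans (sym (⊙-⊘ d u)) (trans (cong (_⊘ d) du≡dv) (⊙-⊘ d v))

  -- Congruence classes and their verification modulo K

  data Literal : Set where
    ⟨_≡_mod_⟩ ⟨_≢_mod_⟩ : ℤ³ → ℤ → ℕ → Literal

  modulus : Literal → ℕ
  modulus ⟨ _ ≡ _ mod m ⟩ = m
  modulus ⟨ _ ≢ _ mod m ⟩ = m

  holds : Literal → ℤ³ → Bool
  holds ⟨ ℓ ≡ r mod m ⟩ v = does (ℓ · v ≡? r [mod m ])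
  holds ⟨ ℓ ≢ r mod m ⟩ v = not (does (ℓ · v ≡? r [mod m ]))

  negate : Literal → Literal
  negate ⟨ ℓ ≡ r mod m ⟩ = ⟨ ℓ ≢ r mod m ⟩
  negate ⟨ ℓ ≢ r mod m ⟩ = ⟨ ℓ ≡ r mod m ⟩

  holds-negate : ∀ l v → holds (negate l) v ≡ not (holds l v)
  holds-negate ⟨ ℓ ≡ r mod m ⟩ v = refl
  holds-negate ⟨ ℓ ≢ r mod m ⟩ v = sym (Bool.not-involutive _)

  holdsAll : List Literal → ℤ³ → Bool
  holdsAll C v = all (λ l → holds l v) C

  does-sound : ∀ {A : Set} (a? : Dec A) → T (does a?) → A
  does-sound (yes a) _ = a

  does-complete : ∀ {A : Set} (a? : Dec A) → A → T (does a?)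
  does-complete a? a = Equivalence.from Bool.T-≡ (dec-true a? a)

  holds-periodic : ∀ {K v w} l → modulus l ℕ.∣ K → v ≡³ w [mod K ] → holds l v ≡ holds l w
  holds-periodic {v = v} {w} ⟨ ℓ ≡ r mod m ⟩ m∣K v≡w =
    does-⇔ (shift (mod-weaken m∣K (·-mod (≡³-refl ℓ) v≡w))) (ℓ · v ≡? r [mod m ]) (ℓ · w ≡? r [mod m ])
    where
    shift : ∀ {a b} → a ≡ b [mod m ] → (a ≡ r [mod m ]) ⇔ (b ≡ r [mod m ])
    shift a≡b = mk⇔ (mod-trans (mod-sym a≡b)) (mod-trans a≡b)
  holds-periodic ⟨ ℓ ≢ r mod m ⟩ m∣K v≡w = cong not (holds-periodic ⟨ ℓ ≡ r mod m ⟩ m∣K v≡w)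

  holdsAll-periodic : ∀ {K v w C} → All (λ l → modulus l ℕ.∣ K) C → v ≡³ w [mod K ] → holdsAll C v ≡ holdsAll C w
  holdsAll-periodic All.[] v≡w = refl
  holdsAll-periodic {C = l ∷ _} (m∣K All.∷ ms) v≡w =
    cong₂ _∧_ (holds-periodic l m∣K v≡w) (holdsAll-periodic ms v≡w)

  Entails : ℕ → Mat → ℤ → List Literal → List Literal → Bool
  Entails K S q C D =
    all (λ l → does (modulus l ℕ.∣? K)) (C ++ D) ∧
    all (λ v → not (holdsAll C v ∧ does (⟦ S ⟧ v ≡? q [mod K ])) ∨ holdsAll D v) (residues K)

  modus-ponens : ∀ a {b} → T (not a ∨ b) → T a → T b
  modus-ponens true b = λ _ → b

  -- Every modulus divides K, so hypotheses and conclusions depend only on v mod K.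
  entails-sound : ∀ {K} .⦃ _ : NonZero K ⦄ S q C D {v} → Entails K S q C D ≡ true →
    ⟦ S ⟧ v ≡ q [mod K ] → T (holdsAll C v) → T (holdsAll D v)
  entails-sound {K} S q C D {v} check Sv≡q Cv =
    subst T (holdsAll-periodic periodicD (≡³-sym v≡ρ)) (modus-ponens _ (All.lookup grid (residue-∈ K v)) hypρ)
    where
    ρ = residue K v
    v≡ρ = residue-≡³ K v
    split = Equivalence.to Bool.T-∧ (Equivalence.from Bool.T-≡ check)
    periodic : All (λ l → modulus l ℕ.∣ K) (C ++ D)
    periodic = All.map (does-sound (_ ℕ.∣? K)) (All.all⁺ _ (C ++ D) (proj₁ split))
    periodicC = All.++⁻ˡ C periodic
    periodicD = All.++⁻ʳ C periodic
    grid = All.all⁺ _ (residues K) (proj₂ split)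
    hypρ : T (holdsAll C ρ ∧ does (⟦ S ⟧ ρ ≡? q [mod K ]))
    hypρ = Equivalence.from Bool.T-∧
      ( subst T (holdsAll-periodic periodicC v≡ρ) Cv
      , does-complete (⟦ S ⟧ ρ ≡? q [mod K ]) (mod-trans (mod-sym (⟦⟧-mod S v≡ρ)) Sv≡q))

  ⟪_≡_mod_⟫ : Mat → ℤ³ → ℕ → List Literal
  ⟪ (r , s , t) ≡ (a , b , c) mod m ⟫ = ⟨ r ≡ a mod m ⟩ ∷ ⟨ s ≡ b mod m ⟩ ∷ ⟨ t ≡ c mod m ⟩ ∷ []

  ⟪⟫-holds : ∀ A w m v → T (holdsAll ⟪ A ≡ w mod m ⟫ v) ⇔ A ⊛ v ≡³ w [mod m ]
  ⟪⟫-holds (r , s , t) (a , b , c) m v = mk⇔ to from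
    where
    to : T (holdsAll ⟪ (r , s , t) ≡ (a , b , c) mod m ⟫ v) → (r , s , t) ⊛ v ≡³ (a , b , c) [mod m ]
    to h = let (hr , h) = Equivalence.to Bool.T-∧ h
               (hs , h) = Equivalence.to Bool.T-∧ h
               (ht , _) = Equivalence.to Bool.T-∧ h
           in mod³ (does-sound (r · v ≡? a [mod m ]) hr) (does-sound (s · v ≡? b [mod m ]) hs)
                   (does-sound (t · v ≡? c [mod m ]) ht)
    from : (r , s , t) ⊛ v ≡³ (a , b , c) [mod m ] → T (holdsAll ⟪ (r , s , t) ≡ (a , b , c) mod m ⟫ v)
    from (mod³ hr hs ht) = Equivalence.from Bool.T-∧ (does-complete (r · v ≡? a [mod m ]) hr ,
                           Equivalence.from Bool.T-∧ (does-complete (s · v ≡? b [mod m ]) hs ,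
                           Equivalence.from Bool.T-∧ (does-complete (t · v ≡? c [mod m ]) ht , _)))

  -- If L v = d w then (Lᵀ ℓ)·v = d (ℓ·w), so ℓ·w ≡ r (mod m) iff (Lᵀ ℓ)·v ≡ d r (mod d m).
  transport : Mat → ℕ → Literal → Literal
  transport L d ⟨ ℓ ≡ r mod m ⟩ = ⟨ L ᵀ ⊛ ℓ ≡ + d * r mod d ℕ.* m ⟩
  transport L d ⟨ ℓ ≢ r mod m ⟩ = ⟨ L ᵀ ⊛ ℓ ≢ + d * r mod d ℕ.* m ⟩

  holds-transport : ∀ {L d v w} .⦃ _ : NonZero d ⦄ l → L ⊛ v ≡ + d ⊙ w → holds (transport L d l) v ≡ holds l w
  holds-transport {L} {d} {v} {w} ⟨ ℓ ≡ r mod m ⟩ Lv≡dw = does-⇔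
    (subst (λ x → (x ≡ + d * r [mod d ℕ.* m ]) ⇔ (ℓ · w ≡ r [mod m ])) (sym value) (mod-*-cancel d m))
    ((L ᵀ ⊛ ℓ) · v ≡? + d * r [mod d ℕ.* m ]) (ℓ · w ≡? r [mod m ])
    where
    value : (L ᵀ ⊛ ℓ) · v ≡ + d * (ℓ · w)
    value = begin
      (L ᵀ ⊛ ℓ) · v    ≡⟨ ·-⊛ ℓ L v ⟨
      ℓ · (L ⊛ v)      ≡⟨ cong (ℓ ·_) Lv≡dw ⟩
      ℓ · (+ d ⊙ w)    ≡⟨ ·-⊙ʳ (+ d) ℓ w ⟩
      + d * (ℓ · w)    ∎
      where open ≡-Reasoning
  holds-transport {L} {d} {v} {w} ⟨ ℓ ≢ r mod m ⟩ Lv≡dw =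
    cong not (holds-transport {L} {d} {v} {w} ⟨ ℓ ≡ r mod m ⟩ Lv≡dw)

  holdsAll-transport : ∀ {L d v w} .⦃ _ : NonZero d ⦄ D → L ⊛ v ≡ + d ⊙ w →
    holdsAll (map (transport L d) D) v ≡ holdsAll D w
  holdsAll-transport []      _     = refl
  holdsAll-transport (l ∷ D) Lv≡dw = cong₂ _∧_ (holds-transport l Lv≡dw) (holdsAll-transport D Lv≡dw)

  MapsInto : ℕ → Mat → ℤ → Mat → ℕ → List Literal → List Literal → Bool
  MapsInto K S q L d C D = Entails K S q C (⟪ L ≡ 0³ mod d ⟫ ++ map (transport L d) D)

  -- Counting solutions in a box

  Box : ℕ → ℤ³ → Set
  Box B (x , y , z) = ∣ x ∣ ℕ.≤ B × ∣ y ∣ ℕ.≤ B × ∣ z ∣ ℕ.≤ B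

  Bounded : ℕ → (ℤ³ → Bool) → Set
  Bounded B p = ∀ v → T (p v) → Box B v

  intRange-∈ : ∀ {B} x → ∣ x ∣ ℕ.≤ B → x ∈ intRange B
  intRange-∈ (+ k)      k≤B  = ∈-++⁺ˡ (∈-map⁺ +_ (∈-upTo⁺ (s≤s k≤B)))
  intRange-∈ {B} -[1+ k ] k<B = ∈-++⁺ʳ (map +_ (upTo (suc B))) (∈-map⁺ -[1+_] (∈-upTo⁺ k<B))

  intRange-unique : ∀ B → Unique (intRange B)
  intRange-unique B = Unique.++⁺
    (Unique.map⁺ ℤ.+-injective (Unique.upTo⁺ (suc B)))
    (Unique.map⁺ ℤ.-[1+-injective (Unique.upTo⁺ B))
    sign-clash
    where
    sign-clash : ∀ {v} → v ∈ map +_ (upTo (suc B)) × v ∈ map -[1+_] (upTo B) → ⊥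
    sign-clash (v∈⁺ , v∈⁻) with ∈-map⁻ +_ v∈⁺ | ∈-map⁻ -[1+_] v∈⁻
    ... | _ , _ , refl | _ , _ , ()

  concatMap-map : ∀ {A B C : Set} (f : A → B → C) xs ys →
    concatMap (λ x → map (f x) ys) xs ≡ cartesianProductWith f xs ys
  concatMap-map f []       ys = refl
  concatMap-map f (x ∷ xs) ys = cong (map (f x) ys ++_) (concatMap-map f xs ys)

  triples-cartesian : ∀ B → triples B ≡ cartesianProduct (intRange B) (cartesianProduct (intRange B) (intRange B))
  triples-cartesian B = begin
    concatMap (λ x → concatMap (λ y → map (λ z → x , y , z) R) R) R
      ≡⟨ List.concatMap-cong (λ x → List.concatMap-cong (λ y → List.map-∘ R) R) R ⟩
    concatMap (λ x → concatMap (λ y → map (x ,_) (map (y ,_) R)) R) R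
      ≡⟨ List.concatMap-cong (λ x → List.map-concatMap (x ,_) (λ y → map (y ,_) R) R) R ⟨
    concatMap (λ x → map (x ,_) (concatMap (λ y → map (y ,_) R) R)) R
      ≡⟨ List.concatMap-cong (λ x → cong (map (x ,_)) (concatMap-map _,_ R R)) R ⟩
    concatMap (λ x → map (x ,_) (cartesianProduct R R)) R
      ≡⟨ concatMap-map _,_ R (cartesianProduct R R) ⟩
    cartesianProduct R (cartesianProduct R R)
      ∎
    where
    open ≡-Reasoning
    R = intRange B

  triples-∈ : ∀ {B} v → Box B v → v ∈ triples B
  triples-∈ {B} (x , y , z) (x≤B , y≤B , z≤B) = subst ((x , y , z) ∈_) (sym (triples-cartesian B))
    (∈-cartesianProduct⁺ (intRange-∈ x x≤B) (∈-cartesianProduct⁺ (intRange-∈ y y≤B) (intRange-∈ z z≤B)))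

  triples-unique : ∀ B → Unique (triples B)
  triples-unique B = subst Unique (sym (triples-cartesian B))
    (Unique.cartesianProduct⁺ (intRange-unique B)
      (Unique.cartesianProduct⁺ (intRange-unique B) (intRange-unique B)))

  record Bijection (p q : ℤ³ → Bool) : Set where
    field
      to from    : ℤ³ → ℤ³
      to-sound   : ∀ {v} → T (p v) → T (q (to v))
      from-sound : ∀ {w} → T (q w) → T (p (from w))
      from-to    : ∀ {v} → T (p v) → from (to v) ≡ v
      to-from    : ∀ {w} → T (q w) → to (from w) ≡ w

  solutions : ℕ → (ℤ³ → Bool) → List ℤ³
  solutions B p = filter (λ v → T? (p v)) (triples B)

  solutions-∈ : ∀ {B p v} → Bounded B p → T (p v) → v ∈ solutions B p
  solutions-∈ {p = p} {v} bounded pv = ∈-filter⁺ (λ v → T? (p v)) (triples-∈ v (bounded v pv)) pv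

  solutions-sound : ∀ B p {v} → v ∈ solutions B p → T (p v)
  solutions-sound B p = proj₂ ∘ ∈-filter⁻ (λ v → T? (p v))

  count-bijection : ∀ {B B′ p q} → Bounded B p → Bounded B′ q → Bijection p q → countIn B p ≡ countIn B′ q
  count-bijection {B} {B′} {p} {q} bp bq f = begin
    length (solutions B p)            ≡⟨ List.length-map to (solutions B p) ⟨
    length (map to (solutions B p))   ≡⟨ ↭-length (∼bag⇒↭ (unique∧set⇒bag image-unique
                                           (Unique.filter⁺ (λ v → T? (q v)) (triples-unique B′)) same-elements)) ⟩
    length (solutions B′ q)           ∎
    where
    open ≡-Reasoning
    open Bijection f
    image-unique : Unique (map to (solutions B p))
    image-unique = Unique.map⁻ {f = from} (subst Unique (sym (trans (sym (List.map-∘ (solutions B p)))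
      (List.map-id-local (All.tabulate (from-to ∘ solutions-sound B p)))))
      (Unique.filter⁺ (λ v → T? (p v)) (triples-unique B)))
    same-elements : ∀ {w} → (w ∈ map to (solutions B p)) ⇔ (w ∈ solutions B′ q)
    same-elements = mk⇔
      (λ w∈ → let (v , v∈ , w≡) = ∈-map⁻ to w∈ in
        subst (_∈ _) (sym w≡) (solutions-∈ bq (to-sound (solutions-sound B p v∈))))
      (λ w∈ → let qw = solutions-sound B′ q w∈ in
        subst (_∈ _) (to-from qw) (∈-map⁺ to (solutions-∈ bp (from-sound qw))))

  count-cong : ∀ B {p q : ℤ³ → Bool} → (∀ v → p v ≡ q v) → countIn B p ≡ countIn B q
  count-cong B {p} {q} p≗q = cong length
    (List.filter-≐ (λ v → T? (p v)) (λ v → T? (q v)) (subst T (p≗q _) , subst T (sym (p≗q _))) (triples B))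

  filter-split : ∀ (e φ c : ℤ³ → Bool) xs →
    length (filter (λ v → T? (e v ∧ c v)) xs)
      ≡ length (filter (λ v → T? (e v ∧ (φ v ∧ c v))) xs)
          ℕ.+ length (filter (λ v → T? (e v ∧ (not (φ v) ∧ c v))) xs)
  filter-split e φ c [] = refl
  filter-split e φ c (x ∷ xs) with e x | φ x | c x
  ... | false | _     | _     = filter-split e φ c xs
  ... | true  | true  | false = filter-split e φ c xs
  ... | true  | false | false = filter-split e φ c xs
  ... | true  | true  | true  = cong suc (filter-split e φ c xs)
  ... | true  | false | true  = trans (cong suc (filter-split e φ c xs)) (sym (ℕ.+-suc _ _))

  -- Transfers between congruence classes

  Solution : Mat → ℕ → List Literal → ℤ³ → Bool
  Solution S M C v = does (⟦ S ⟧ v ≟ + M) ∧ holdsAll C v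

  solution-⇔ : ∀ S M C v → T (Solution S M C v) ⇔ (⟦ S ⟧ v ≡ + M × T (holdsAll C v))
  solution-⇔ S M C v = mk⇔
    (λ sol → let (Sv≡M , Cv) = Equivalence.to Bool.T-∧ sol in does-sound (⟦ S ⟧ v ≟ + M) Sv≡M , Cv)
    (λ (Sv≡M , Cv) → Equivalence.from Bool.T-∧ (does-complete (⟦ S ⟧ v ≟ + M) Sv≡M , Cv))

  #Solutions : Mat → ℕ → List Literal → ℕ
  #Solutions S M C = countIn M (Solution S M C)

  count-split : ∀ B S M l C → countIn B (Solution S M C)
    ≡ countIn B (Solution S M (l ∷ C)) ℕ.+ countIn B (Solution S M (negate l ∷ C))
  count-split B S M l C = trans (filter-split (λ v → does (⟦ S ⟧ v ≟ + M)) (holds l) (holdsAll C) (triples B))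
    (cong (countIn B (Solution S M (l ∷ C)) ℕ.+_)
      (count-cong B (λ v → cong (λ b → does (⟦ S ⟧ v ≟ + M) ∧ (b ∧ holdsAll C v)) (sym (holds-negate l v)))))

  holdsAll-++ : ∀ C {D v} → T (holdsAll (C ++ D) v) → T (holdsAll C v) × T (holdsAll D v)
  holdsAll-++ C {D} {v} h = let (hC , hD) = All.++⁻ C (All.all⁺ (λ l → holds l v) (C ++ D) h)
                            in All.all⁻ _ hC , All.all⁻ _ hD

  ⊙-* : ∀ k l v → (k * l) ⊙ v ≡ k ⊙ l ⊙ v
  ⊙-* k l (x , y , z) = triple-≡ (ℤ.*-assoc k l x) (ℤ.*-assoc k l y) (ℤ.*-assoc k l z)

  module _ {K S q M} .⦃ _ : NonZero K ⦄ (M≡q : + M ≡ q [mod K ])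
    {C D} d e .⦃ _ : NonZero d ⦄ .⦃ _ : NonZero e ⦄ L L′
    (scales : ∀ v → ⟦ S ⟧ (L ⊛ v) ≡ + d * + d * ⟦ S ⟧ v)
    (inverts : ∀ v → L′ ⊛ L ⊛ v ≡ (+ d * + e) ⊙ v)
    (check : MapsInto K S q L d C D ≡ true)
    where

    transfer-step : ∀ {v} → T (Solution S M C v) →
      T (Solution S M D ((L ⊛ v) ⊘ d)) × (L′ ⊛ (L ⊛ v) ⊘ d) ⊘ e ≡ v
    transfer-step {v} sol = Equivalence.from (solution-⇔ S M D w) (Sw≡M , Dw) , back
      where
      Sv≡M = proj₁ (Equivalence.to (solution-⇔ S M C v) sol)
      conclusions = holdsAll-++ ⟪ L ≡ 0³ mod d ⟫ {map (transport L d) D} {v}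
        (entails-sound S q C (⟪ L ≡ 0³ mod d ⟫ ++ map (transport L d) D) check
          (subst (_≡ q [mod K ]) (sym Sv≡M) M≡q) (proj₂ (Equivalence.to (solution-⇔ S M C v) sol)))
      w = (L ⊛ v) ⊘ d
      dw≡Lv : + d ⊙ w ≡ L ⊛ v
      dw≡Lv = ⊘-exact d (Equivalence.to (⟪⟫-holds L 0³ d v) (proj₁ conclusions))
      Dw : T (holdsAll D w)
      Dw = subst T (holdsAll-transport {L} {d} {v} D (sym dw≡Lv)) (proj₂ conclusions)
      Sw≡M : ⟦ S ⟧ w ≡ + M
      Sw≡M = ℤ.*-cancelˡ-≡ (+ d * + d) _ _ ⦃ ℤ.i*j≢0 (+ d) (+ d) ⦄ (begin
        + d * + d * ⟦ S ⟧ w       ≡⟨ ⟦⟧-⊙ (+ d) S w ⟨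
        ⟦ S ⟧ (+ d ⊙ w)           ≡⟨ cong ⟦ S ⟧ dw≡Lv ⟩
        ⟦ S ⟧ (L ⊛ v)             ≡⟨ scales v ⟩
        + d * + d * ⟦ S ⟧ v       ≡⟨ cong (+ d * + d *_) Sv≡M ⟩
        + d * + d * + M           ∎)
        where open ≡-Reasoning
      back : (L′ ⊛ w) ⊘ e ≡ v
      back = trans (cong (_⊘ e) (⊙-cancel d (begin
        + d ⊙ (L′ ⊛ w)            ≡⟨ ⊛-⊙ (+ d) L′ w ⟨
        L′ ⊛ + d ⊙ w              ≡⟨ cong (L′ ⊛_) dw≡Lv ⟩
        L′ ⊛ L ⊛ v                ≡⟨ inverts v ⟩
        (+ d * + e) ⊙ v           ≡⟨ ⊙-* (+ d) (+ e) v ⟩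
        + d ⊙ + e ⊙ v             ∎))) (⊙-⊘ e v)
        where open ≡-Reasoning

  -- Certifies that v ↦ L v / d and w ↦ L′ w / e are inverse bijections between the solutions of
  -- ⟦ S ⟧ v = M in class C and in class D whenever M ≡ q (mod K): the similitude preserves ⟦ S ⟧, and
  -- forward and backward check integrality and the target classes modulo K.
  record Transfer (K : ℕ) (S : Mat) (q : ℤ) (C D : List Literal) : Set where
    field
      d e         : ℕ
      ⦃ d≢0 ⦄     : NonZero d
      ⦃ e≢0 ⦄     : NonZero e
      L L′        : Mat
      similitude  : L ᵀ ∙ S ∙ L ≡ (+ d * + d) • S
      inverseˡ    : L′ ∙ L ≡ (+ d * + e) • I
      inverseʳ    : L ∙ L′ ≡ (+ e * + d) • I
      forward     : MapsInto K S q L d C D ≡ true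
      backward    : MapsInto K S q L′ e D C ≡ true

  scalar-action : ∀ k A B v → A ∙ B ≡ k • I → A ⊛ B ⊛ v ≡ k ⊙ v
  scalar-action k A B v AB≡kI = begin
    A ⊛ B ⊛ v       ≡⟨ ⊛-∙ A B v ⟨
    (A ∙ B) ⊛ v     ≡⟨ cong (_⊛ v) AB≡kI ⟩
    (k • I) ⊛ v     ≡⟨ •-⊛ k I v ⟩
    k ⊙ (I ⊛ v)     ≡⟨ cong (k ⊙_) (I-⊛ v) ⟩
    k ⊙ v           ∎
    where open ≡-Reasoning

  similitude-scales : ∀ k S L v → L ᵀ ∙ S ∙ L ≡ k • S → ⟦ S ⟧ (L ⊛ v) ≡ k * ⟦ S ⟧ v
  similitude-scales k S L v sim = begin
    ⟦ S ⟧ (L ⊛ v)         ≡⟨ ⟦⟧-pullback S L v ⟨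
    ⟦ L ᵀ ∙ S ∙ L ⟧ v     ≡⟨ cong (λ A → ⟦ A ⟧ v) sim ⟩
    ⟦ k • S ⟧ v           ≡⟨ ⟦⟧-• k S v ⟩
    k * ⟦ S ⟧ v           ∎
    where open ≡-Reasoning

  inverse-similitude-scales : ∀ d e .⦃ _ : NonZero d ⦄ S L L′ v → L ᵀ ∙ S ∙ L ≡ (+ d * + d) • S →
    L ∙ L′ ≡ (+ e * + d) • I → ⟦ S ⟧ (L′ ⊛ v) ≡ + e * + e * ⟦ S ⟧ v
  inverse-similitude-scales d e S L L′ v sim inv = ℤ.*-cancelˡ-≡ (+ d * + d) _ _ ⦃ ℤ.i*j≢0 (+ d) (+ d) ⦄ (begin
    + d * + d * ⟦ S ⟧ (L′ ⊛ v)                ≡⟨ similitude-scales (+ d * + d) S L (L′ ⊛ v) sim ⟨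
    ⟦ S ⟧ (L ⊛ L′ ⊛ v)                        ≡⟨ cong ⟦ S ⟧ (scalar-action (+ e * + d) L L′ v inv) ⟩
    ⟦ S ⟧ ((+ e * + d) ⊙ v)                   ≡⟨ ⟦⟧-⊙ (+ e * + d) S v ⟩
    (+ e * + d) * (+ e * + d) * ⟦ S ⟧ v       ≡⟨ regroup (+ d) (+ e) (⟦ S ⟧ v) ⟩
    + d * + d * (+ e * + e * ⟦ S ⟧ v)         ∎)
    where
    open ≡-Reasoning
    regroup : ∀ d e x → (e * d) * (e * d) * x ≡ d * d * (e * e * x)
    regroup = solve-∀

  transfer-count : ∀ {K S q C D B M} .⦃ _ : NonZero K ⦄ → Transfer K S q C D → + M ≡ q [mod K ] →
    (∀ v → ⟦ S ⟧ v ≡ + M → Box B v) → countIn B (Solution S M C) ≡ countIn B (Solution S M D)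
  transfer-count {K} {S} {q} {C} {D} {B} {M} t M≡q bound = count-bijection (bounded C) (bounded D) (record
    { to = λ v → (L ⊛ v) ⊘ d ; from = λ w → (L′ ⊛ w) ⊘ e
    ; to-sound = proj₁ ∘ forth ; from-sound = proj₁ ∘ back
    ; from-to = proj₂ ∘ forth ; to-from = proj₂ ∘ back })
    where
    open Transfer t
    bounded : ∀ C → Bounded B (Solution S M C)
    bounded C v sol = bound v (proj₁ (Equivalence.to (solution-⇔ S M C v) sol))
    forth = transfer-step {K} {S} {q} {M} M≡q {C} {D} d e L L′
      (λ v → similitude-scales (+ d * + d) S L v similitude)
      (λ v → scalar-action (+ d * + e) L′ L v inverseˡ) forward
    back = transfer-step {K} {S} {q} {M} M≡q {D} {C} e d L′ L
      (λ v → inverse-similitude-scales d e S L L′ v similitude inverseʳ)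
      (λ v → scalar-action (+ e * + d) L L′ v inverseʳ)
      backward

  split-double : ∀ {K S q C D φ B M} .⦃ _ : NonZero K ⦄ →
    Transfer K S q D (φ ∷ C) → Transfer K S q D (negate φ ∷ C) → + M ≡ q [mod K ] →
    (∀ v → ⟦ S ⟧ v ≡ + M → Box B v) → countIn B (Solution S M C) ≡ 2 ℕ.* countIn B (Solution S M D)
  split-double {S = S} {C = C} {D} {φ} {B} {M} t⁺ t⁻ M≡q bound = begin
    countIn B (Solution S M C)                     ≡⟨ count-split B S M φ C ⟩
    countIn B (Solution S M (φ ∷ C)) ℕ.+ countIn B (Solution S M (negate φ ∷ C))
      ≡⟨ cong₂ ℕ._+_ (transfer-count t⁺ M≡q bound) (transfer-count t⁻ M≡q bound) ⟨
    #D ℕ.+ #D                                      ≡⟨ cong (#D ℕ.+_) (ℕ.+-identityʳ #D) ⟨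
    2 ℕ.* #D                                       ∎
    where
    open ≡-Reasoning
    #D = countIn B (Solution S M D)

  split-transfer : ∀ {K S q C D φ ψ B M} .⦃ _ : NonZero K ⦄ →
    Transfer K S q (φ ∷ C) (ψ ∷ D) → Transfer K S q (negate φ ∷ C) (negate ψ ∷ D) → + M ≡ q [mod K ] →
    (∀ v → ⟦ S ⟧ v ≡ + M → Box B v) → countIn B (Solution S M C) ≡ countIn B (Solution S M D)
  split-transfer {S = S} {C = C} {D} {φ} {ψ} {B} {M} t⁺ t⁻ M≡q bound = begin
    countIn B (Solution S M C)                     ≡⟨ count-split B S M φ C ⟩
    countIn B (Solution S M (φ ∷ C)) ℕ.+ countIn B (Solution S M (negate φ ∷ C))
      ≡⟨ cong₂ ℕ._+_ (transfer-count t⁺ M≡q bound) (transfer-count t⁻ M≡q bound) ⟩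
    countIn B (Solution S M (ψ ∷ D)) ℕ.+ countIn B (Solution S M (negate ψ ∷ D))
      ≡⟨ count-split B S M ψ D ⟨
    countIn B (Solution S M D)                     ∎
    where open ≡-Reasoning

  -- Bounded solution sets

  summands-≤ : ∀ {a b c p q r M} .⦃ _ : NonZero a ⦄ .⦃ _ : NonZero b ⦄ .⦃ _ : NonZero c ⦄ →
    a ℕ.* p ℕ.+ b ℕ.* q ℕ.+ c ℕ.* r ≡ M → p ℕ.≤ M × q ℕ.≤ M × r ℕ.≤ M
  summands-≤ {a} {b} {c} {p} {q} {r} refl =
    ℕ.≤-trans (ℕ.m≤n*m p a) (ℕ.≤-trans (ℕ.m≤m+n _ (b ℕ.* q)) (ℕ.m≤m+n _ (c ℕ.* r))) ,
    ℕ.≤-trans (ℕ.m≤n*m q b) (ℕ.≤-trans (ℕ.m≤n+m _ (a ℕ.* p)) (ℕ.m≤m+n _ (c ℕ.* r))) ,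
    ℕ.≤-trans (ℕ.m≤n*m r c) (ℕ.m≤n+m _ (a ℕ.* p ℕ.+ b ℕ.* q))

  weighted-sum : ∀ a b c p q r → + a * + p + + b * + q + + c * + r ≡ + (a ℕ.* p ℕ.+ b ℕ.* q ℕ.+ c ℕ.* r)
  weighted-sum a b c p q r = sym (cong₂ _+_ (cong₂ _+_ (ℤ.pos-* a p) (ℤ.pos-* b q)) (ℤ.pos-* c r))

  summands-bound : ∀ a b c .⦃ _ : NonZero a ⦄ .⦃ _ : NonZero b ⦄ .⦃ _ : NonZero c ⦄ (f : ℤ → ℤ) (F : ℤ → ℕ) →
    (∀ x → f x ≡ + F x) → ∀ {M} x y z → + a * f x + + b * f y + + c * f z ≡ + M →
    F x ℕ.≤ M × F y ℕ.≤ M × F z ℕ.≤ M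
  summands-bound a b c f F f≡F {M} x y z sum≡M = summands-≤ {a} {b} {c} (ℤ.+-injective (begin
    + (a ℕ.* F x ℕ.+ b ℕ.* F y ℕ.+ c ℕ.* F z)    ≡⟨ weighted-sum a b c (F x) (F y) (F z) ⟨
    + a * + F x + + b * + F y + + c * + F z      ≡⟨ cong₂ _+_ (cong₂ _+_ (cong (+ a *_) (f≡F x))
                                                      (cong (+ b *_) (f≡F y))) (cong (+ c *_) (f≡F z)) ⟨
    + a * f x + + b * f y + + c * f z            ≡⟨ sum≡M ⟩
    + M                                          ∎))
    where open ≡-Reasoning

  square-abs : ∀ x → x * x ≡ + (∣ x ∣ ℕ.* ∣ x ∣)
  square-abs (+ n)    = sym (ℤ.pos-* n n)
  square-abs -[1+ n ] = refl

  n≤n*n : ∀ n → n ℕ.≤ n ℕ.* n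
  n≤n*n zero    = z≤n
  n≤n*n (suc n) = ℕ.m≤m*n (suc n) (suc n)

  diag-bounded : ∀ a b c .⦃ _ : NonZero a ⦄ .⦃ _ : NonZero b ⦄ .⦃ _ : NonZero c ⦄ {M} v →
    ⟦ diag a b c ⟧ v ≡ + M → Box M v
  diag-bounded a b c (x , y , z) Sv≡M =
    let (x≤ , y≤ , z≤) = summands-bound a b c (λ x → x * x) (λ x → ∣ x ∣ ℕ.* ∣ x ∣) square-abs x y z
                           (trans (sym (⟦diag⟧ a b c x y z)) Sv≡M)
    in ℕ.≤-trans (n≤n*n ∣ x ∣) x≤ , ℕ.≤-trans (n≤n*n ∣ y ∣) y≤ , ℕ.≤-trans (n≤n*n ∣ z ∣) z≤

  -- Odd and even solutions

  1³ : ℤ³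
  1³ = + 1 , + 1 , + 1

  Even Odd : List Literal
  Even = ⟪ I ≡ 0³ mod 2 ⟫
  Odd  = ⟪ I ≡ 1³ mod 2 ⟫

  ⟪I⟫-holds : ∀ w m v → T (holdsAll ⟪ I ≡ w mod m ⟫ v) ⇔ v ≡³ w [mod m ]
  ⟪I⟫-holds w m v = subst (λ u → T (holdsAll ⟪ I ≡ w mod m ⟫ v) ⇔ u ≡³ w [mod m ]) (I-⊛ v) (⟪⟫-holds I w m v)

  even-solutions : ∀ a b c .⦃ _ : NonZero a ⦄ .⦃ _ : NonZero b ⦄ .⦃ _ : NonZero c ⦄ m →
    N a b c m ≡ #Solutions (diag a b c) (4 ℕ.* m) Even
  even-solutions a b c m =
    trans (count-cong m (λ { (x , y , z) → cong (λ e → does (e ≟ + m)) (sym (⟦diag⟧ a b c x y z)) }))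
    (count-bijection (λ v h → diag-bounded a b c v (does-sound (⟦ S ⟧ v ≟ + m) h))
                     (λ v h → diag-bounded a b c v (proj₁ (Equivalence.to (solution-⇔ S (4 ℕ.* m) Even v) h)))
                     doubling)
    where
    S = diag a b c
    even : ∀ w → T (holdsAll Even w) → w ≡³ 0³ [mod 2 ]
    even w = Equivalence.to (⟪I⟫-holds 0³ 2 w)
    quadruple : ∀ v → ⟦ S ⟧ (+ 2 ⊙ v) ≡ + 4 * ⟦ S ⟧ v
    quadruple v = ⟦⟧-⊙ (+ 2) S v
    doubling : Bijection (λ v → does (⟦ S ⟧ v ≟ + m)) (Solution S (4 ℕ.* m) Even)
    doubling = record
      { to = + 2 ⊙_
      ; from = _⊘ 2
      ; to-sound = λ {v} h → Equivalence.from (solution-⇔ S (4 ℕ.* m) Even (+ 2 ⊙ v))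
          ( trans (quadruple v) (trans (cong (+ 4 *_) (does-sound (⟦ S ⟧ v ≟ + m) h)) (sym (ℤ.pos-* 4 m)))
          , Equivalence.from (⟪I⟫-holds 0³ 2 (+ 2 ⊙ v)) (⊙-≡³0 2 v))
      ; from-sound = λ {w} h → let (Sw≡4m , Ew) = Equivalence.to (solution-⇔ S (4 ℕ.* m) Even w) h in
          does-complete (⟦ S ⟧ (w ⊘ 2) ≟ + m) (ℤ.*-cancelˡ-≡ (+ 4) _ _ (begin
            + 4 * ⟦ S ⟧ (w ⊘ 2)      ≡⟨ quadruple (w ⊘ 2) ⟨
            ⟦ S ⟧ (+ 2 ⊙ w ⊘ 2)      ≡⟨ cong ⟦ S ⟧ (⊘-exact 2 (even w Ew)) ⟩
            ⟦ S ⟧ w                  ≡⟨ Sw≡4m ⟩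
            + (4 ℕ.* m)              ≡⟨ ℤ.pos-* 4 m ⟩
            + 4 * + m                ∎))
      ; from-to = λ {v} _ → ⊙-⊘ 2 v
      ; to-from = λ {w} h → ⊘-exact 2 (even w (proj₂ (Equivalence.to (solution-⇔ S (4 ℕ.* m) Even w) h)))
      }
      where open ≡-Reasoning

  pronic-abs : ∀ x → x * (x + + 1) ≡ + (∣ x ∣ ℕ.* ∣ x + + 1 ∣)
  pronic-abs (+ n)          = sym (ℤ.pos-* n (n ℕ.+ 1))
  pronic-abs -[1+ zero ]    = refl
  pronic-abs -[1+ suc n ]   = refl

  halve-≤ : ∀ k l {n} → 2 ℕ.≤ l → k ℕ.* l ℕ.≤ 2 ℕ.* n → k ℕ.≤ n
  halve-≤ k l 2≤l kl≤2n =
    ℕ.*-cancelˡ-≤ 2 (ℕ.≤-trans (ℕ.≤-reflexive (ℕ.*-comm 2 k)) (ℕ.≤-trans (ℕ.*-monoʳ-≤ k 2≤l) kl≤2n))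

  pronic-bound : ∀ x {n} → ∣ x ∣ ℕ.* ∣ x + + 1 ∣ ℕ.≤ 2 ℕ.* n → ∣ x ∣ ℕ.≤ suc n
  pronic-bound (+ zero)      _ = z≤n
  pronic-bound (+ suc k)     h = ℕ.m≤n⇒m≤1+n (halve-≤ (suc k) (suc k ℕ.+ 1) (s≤s (ℕ.m≤n+m 1 k)) h)
  pronic-bound -[1+ zero ]   _ = s≤s z≤n
  pronic-bound -[1+ suc j ]  h =
    s≤s (halve-≤ (suc j) (suc (suc j)) (s≤s (s≤s z≤n))
      (ℕ.≤-trans (ℕ.≤-reflexive (ℕ.*-comm (suc j) (suc (suc j)))) h))

  odd↑ odd↓ : ℤ³ → ℤ³
  odd↑ (x , y , z) = + 2 * x + + 1 , + 2 * y + + 1 , + 2 * z + + 1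
  odd↓ (x , y , z) = (x - + 1) /ℕ 2 , (y - + 1) /ℕ 2 , (z - + 1) /ℕ 2

  odd↑-≡1 : ∀ v → odd↑ v ≡³ 1³ [mod 2 ]
  odd↑-≡1 (x , y , z) = mod³ (odd x) (odd y) (odd z)
    where
    odd : ∀ x → + 2 * x + + 1 ≡ + 1 [mod 2 ]
    odd x = mod (divides x (shift x))
      where
      shift : ∀ x → + 2 * x + + 1 - + 1 ≡ x * + 2
      shift = solve-∀

  odd↓-odd↑ : ∀ v → odd↓ (odd↑ v) ≡ v
  odd↓-odd↑ (x , y , z) = triple-≡ (halve x) (halve y) (halve z)
    where
    halve : ∀ x → (+ 2 * x + + 1 - + 1) /ℕ 2 ≡ x
    halve x = trans (cong (_/ℕ 2) (shift x)) (*-/ℕ 2 x)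
      where
      shift : ∀ x → + 2 * x + + 1 - + 1 ≡ + 2 * x
      shift = solve-∀

  odd↑-odd↓ : ∀ {w} → w ≡³ 1³ [mod 2 ] → odd↑ (odd↓ w) ≡ w
  odd↑-odd↓ (mod³ x≡1 y≡1 z≡1) = triple-≡ (restore x≡1) (restore y≡1) (restore z≡1)
    where
    restore : ∀ {x} → x ≡ + 1 [mod 2 ] → + 2 * ((x - + 1) /ℕ 2) + + 1 ≡ x
    restore {x} (mod 2∣x-1) =
      trans (cong (_+ + 1) (/ℕ-exact {x - + 1} 2 (mod (subst (+ 2 ∣_) (sym (ℤ.+-identityʳ (x - + 1))) 2∣x-1))))
      (unshift x)
      where
      unshift : ∀ x → x - + 1 + + 1 ≡ x
      unshift = solve-∀

  pronicSum : ℕ → ℕ → ℕ → ℤ³ → ℤ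
  pronicSum a b c (x , y , z) = + a * (x * (x + + 1)) + + b * (y * (y + + 1)) + + c * (z * (z + + 1))

  pronicSum-bounded : ∀ a b c .⦃ _ : NonZero a ⦄ .⦃ _ : NonZero b ⦄ .⦃ _ : NonZero c ⦄ n →
    Bounded (suc n) (λ v → does (pronicSum a b c v ≟ + (2 ℕ.* n)))
  pronicSum-bounded a b c n (x , y , z) h =
    let (x≤ , y≤ , z≤) = summands-bound a b c (λ x → x * (x + + 1)) (λ x → ∣ x ∣ ℕ.* ∣ x + + 1 ∣) pronic-abs x y z
                           (does-sound (pronicSum a b c (x , y , z) ≟ + (2 ℕ.* n)) h)
    in pronic-bound x x≤ , pronic-bound y y≤ , pronic-bound z z≤

  ⟦diag⟧-odd↑ : ∀ a b c v → ⟦ diag a b c ⟧ (odd↑ v) ≡ + 4 * pronicSum a b c v + (+ a + + b + + c)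
  ⟦diag⟧-odd↑ a b c (x , y , z) =
    trans (⟦diag⟧ a b c (+ 2 * x + + 1) (+ 2 * y + + 1) (+ 2 * z + + 1)) (expand (+ a) (+ b) (+ c) x y z)
    where
    expand : ∀ a b c x y z →
      a * ((+ 2 * x + + 1) * (+ 2 * x + + 1)) + b * ((+ 2 * y + + 1) * (+ 2 * y + + 1))
        + c * ((+ 2 * z + + 1) * (+ 2 * z + + 1))
        ≡ + 4 * (a * (x * (x + + 1)) + b * (y * (y + + 1)) + c * (z * (z + + 1))) + (a + b + c)
    expand = solve-∀

  odd-solutions : ∀ a b c .⦃ _ : NonZero a ⦄ .⦃ _ : NonZero b ⦄ .⦃ _ : NonZero c ⦄ k n → a ℕ.+ b ℕ.+ c ≡ 4 ℕ.* k →
    t a b c n ≡ #Solutions (diag a b c) (4 ℕ.* (2 ℕ.* n ℕ.+ k)) Odd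
  odd-solutions a b c k n abc≡4k = count-bijection (pronicSum-bounded a b c n)
    (λ v h → diag-bounded a b c v (proj₁ (Equivalence.to (solution-⇔ S M Odd v) h))) oddification
    where
    S = diag a b c
    M = 4 ℕ.* (2 ℕ.* n ℕ.+ k)
    E = pronicSum a b c
    odd : ∀ w → T (holdsAll Odd w) → w ≡³ 1³ [mod 2 ]
    odd w = Equivalence.to (⟪I⟫-holds 1³ 2 w)
    M≡ : + 4 * + (2 ℕ.* n) + (+ a + + b + + c) ≡ + M
    M≡ = begin
      + 4 * + (2 ℕ.* n) + (+ a + + b + + c)    ≡⟨ cong₂ _+_ (ℤ.pos-* 4 (2 ℕ.* n)) (cong +_ (sym abc≡4k)) ⟨
      + (4 ℕ.* (2 ℕ.* n) ℕ.+ 4 ℕ.* k)          ≡⟨ cong +_ (ℕ.*-distribˡ-+ 4 (2 ℕ.* n) k) ⟨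
      + M                                      ∎
      where open ≡-Reasoning
    oddification : Bijection (λ v → does (E v ≟ + (2 ℕ.* n))) (Solution S M Odd)
    oddification = record
      { to = odd↑
      ; from = odd↓
      ; to-sound = λ {v} h → Equivalence.from (solution-⇔ S M Odd (odd↑ v))
          ( trans (⟦diag⟧-odd↑ a b c v)
              (trans (cong (λ e → + 4 * e + (+ a + + b + + c)) (does-sound (E v ≟ + (2 ℕ.* n)) h)) M≡)
          , Equivalence.from (⟪I⟫-holds 1³ 2 (odd↑ v)) (odd↑-≡1 v))
      ; from-sound = λ {w} h → let (Sw≡M , Ow) = Equivalence.to (solution-⇔ S M Odd w) h in
          does-complete (E (odd↓ w) ≟ + (2 ℕ.* n)) (ℤ.*-cancelˡ-≡ (+ 4) _ _ (+-cancelʳ (+ a + + b + + c) _ _ (begin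
            + 4 * E (odd↓ w) + (+ a + + b + + c)     ≡⟨ ⟦diag⟧-odd↑ a b c (odd↓ w) ⟨
            ⟦ S ⟧ (odd↑ (odd↓ w))                   ≡⟨ cong ⟦ S ⟧ (odd↑-odd↓ (odd w Ow)) ⟩
            ⟦ S ⟧ w                                 ≡⟨ Sw≡M ⟩
            + M                                     ≡⟨ M≡ ⟨
            + 4 * + (2 ℕ.* n) + (+ a + + b + + c)   ∎)))
      ; from-to = λ {v} _ → odd↓-odd↑ v
      ; to-from = λ {w} h → odd↑-odd↓ (odd w (proj₂ (Equivalence.to (solution-⇔ S M Odd w) h)))
      }
      where open ≡-Reasoning

  t≡2N : ∀ a b c .⦃ _ : NonZero a ⦄ .⦃ _ : NonZero b ⦄ .⦃ _ : NonZero c ⦄ k n → a ℕ.+ b ℕ.+ c ≡ 4 ℕ.* k →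
    #Solutions (diag a b c) (4 ℕ.* (2 ℕ.* n ℕ.+ k)) Odd
      ≡ 2 ℕ.* #Solutions (diag a b c) (4 ℕ.* (2 ℕ.* n ℕ.+ k)) Even →
    t a b c n ≡ 2 ℕ.* N a b c (2 ℕ.* n ℕ.+ k)
  t≡2N a b c k n abc≡4k odd≡2even = begin
    t a b c n                            ≡⟨ odd-solutions a b c k n abc≡4k ⟩
    #Solutions S M Odd                   ≡⟨ odd≡2even ⟩
    2 ℕ.* #Solutions S M Even            ≡⟨ cong (2 ℕ.*_) (even-solutions a b c (2 ℕ.* n ℕ.+ k)) ⟨
    2 ℕ.* N a b c (2 ℕ.* n ℕ.+ k)        ∎
    where
    open ≡-Reasoning
    S = diag a b c
    M = 4 ℕ.* (2 ℕ.* n ℕ.+ k)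

  4[2n+k]-mod-32 : ∀ n r k → n ℕ.% 4 ≡ r → + (4 ℕ.* (2 ℕ.* n ℕ.+ k)) ≡ + (4 ℕ.* (2 ℕ.* r ℕ.+ k) ℕ.% 32) [mod 32 ]
  4[2n+k]-mod-32 n r k n%4≡r = mod-trans (mod (divides (+ q) (begin
    + (4 ℕ.* (2 ℕ.* n ℕ.+ k)) - + M₀     ≡⟨ cong (λ m → + m - + M₀) expand ⟩
    + (M₀ ℕ.+ q ℕ.* 32) - + M₀           ≡⟨ cong (λ m → + M₀ + m - + M₀) (ℤ.pos-* q 32) ⟩
    + M₀ + + q * + 32 - + M₀             ≡⟨ [a+b]-a≡b (+ M₀) (+ q * + 32) ⟩
    + q * + 32                           ∎))) (≡-%ℕ (+ M₀) 32)
    where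
    open ≡-Reasoning
    q = n ℕ./ 4
    M₀ = 4 ℕ.* (2 ℕ.* r ℕ.+ k)
    regroup : ∀ r q k → 4 ℕ.* (2 ℕ.* (r ℕ.+ q ℕ.* 4) ℕ.+ k) ≡ 4 ℕ.* (2 ℕ.* r ℕ.+ k) ℕ.+ q ℕ.* 32
    regroup = ℕ-Solver.solve-∀
    expand : 4 ℕ.* (2 ℕ.* n ℕ.+ k) ≡ M₀ ℕ.+ q ℕ.* 32
    expand = trans (cong (λ m → 4 ℕ.* (2 ℕ.* m ℕ.+ k)) (trans (ℕ.m≡m%n+[m/n]*n n 4) (cong (ℕ._+ q ℕ.* 4) n%4≡r)))
                   (regroup r q k)

  -- The five forms

  -- Overloaded integer literals are kept local: elsewhere ℕ literals would become fromNat applications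
  -- and block instance search for NonZero.
  module _ where
    open import Agda.Builtin.FromNat
    open import Agda.Builtin.FromNeg
    open import Data.Unit using (tt)
    import Data.Nat.Literals as ℕ
    import Data.Integer.Literals as ℤ

    instance
      _ = tt
      _ = ℕ.number
      _ = ℤ.number
      _ = ℤ.negative

    odd≡2even-1-4-7 : ∀ {M} → + M ≡ 20 [mod 32 ] →
      #Solutions (diag 1 4 7) M Odd ≡ 2 ℕ.* #Solutions (diag 1 4 7) M Even
    odd≡2even-1-4-7 M≡20 = split-double even→odd∧φ even→odd∧¬φ M≡20 (diag-bounded 1 4 7)
      where
      φ : Literal
      φ = ⟨ (-1 , 0 , -1) ≡ 2 mod 4 ⟩
      even→odd∧φ : Transfer 32 (diag 1 4 7) 20 Even (φ ∷ Odd)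
      even→odd∧φ = record
        { d = 4 ; e = 8
        ; L  = (0 , -6 , -7) , (-2 , 0 , 0) , (0 , 2 , -3)
        ; L′ = (0 , -16 , 0) , (-3 , 0 , 7) , (-2 , 0 , -6)
        ; similitude = refl ; inverseˡ = refl ; inverseʳ = refl ; forward = refl ; backward = refl }
      even→odd∧¬φ : Transfer 32 (diag 1 4 7) 20 Even (negate φ ∷ Odd)
      even→odd∧¬φ = record
        { d = 4 ; e = 8
        ; L  = (0 , -6 , -7) , (-2 , 0 , 0) , (0 , -2 , 3)
        ; L′ = (0 , -16 , 0) , (-3 , 0 , -7) , (-2 , 0 , 6)
        ; similitude = refl ; inverseˡ = refl ; inverseʳ = refl ; forward = refl ; backward = refl }

    odd≡2even-1-7-12 : ∀ {M} → + M ≡ 12 [mod 32 ] →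
      #Solutions (diag 1 7 12) M Odd ≡ 2 ℕ.* #Solutions (diag 1 7 12) M Even
    odd≡2even-1-7-12 M≡12 = trans
      (split-transfer odd∧φ→U∧ψ odd∧¬φ→U∧¬ψ M≡12 (diag-bounded 1 7 12))
      (split-double even→U∧χ even→U∧¬χ M≡12 (diag-bounded 1 7 12))
      where
      φ ψ χ : Literal
      φ = ⟨ (1 , 1 , 0) ≡ 0 mod 4 ⟩
      ψ = ⟨ (-1 , -1 , 0) ≡ 4 mod 8 ⟩
      χ = ⟨ (-1 , 0 , -2) ≡ 0 mod 8 ⟩
      U : List Literal
      U = ⟨ (1 , 0 , 0) ≡ 2 mod 4 ⟩ ∷ ⟨ (0 , 1 , 0) ≡ 2 mod 4 ⟩ ∷ ⟨ (0 , 0 , 1) ≡ 1 mod 2 ⟩ ∷ []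
      odd∧φ→U∧ψ : Transfer 32 (diag 1 7 12) 12 (φ ∷ Odd) (ψ ∷ U)
      odd∧φ→U∧ψ = record
        { d = 4 ; e = 4
        ; L  = (-3 , -7 , 0) , (-1 , 3 , 0) , (0 , 0 , 4)
        ; L′ = (-3 , -7 , 0) , (-1 , 3 , 0) , (0 , 0 , 4)
        ; similitude = refl ; inverseˡ = refl ; inverseʳ = refl ; forward = refl ; backward = refl }
      odd∧¬φ→U∧¬ψ : Transfer 32 (diag 1 7 12) 12 (negate φ ∷ Odd) (negate ψ ∷ U)
      odd∧¬φ→U∧¬ψ = record
        { d = 4 ; e = 4
        ; L  = (-3 , 7 , 0) , (1 , 3 , 0) , (0 , 0 , 4)
        ; L′ = (-3 , 7 , 0) , (1 , 3 , 0) , (0 , 0 , 4)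
        ; similitude = refl ; inverseˡ = refl ; inverseʳ = refl ; forward = refl ; backward = refl }
      even→U∧χ : Transfer 32 (diag 1 7 12) 12 Even (χ ∷ U)
      even→U∧χ = record
        { d = 4 ; e = 4
        ; L  = (-2 , 0 , -12) , (0 , -4 , 0) , (1 , 0 , -2)
        ; L′ = (-2 , 0 , 12) , (0 , -4 , 0) , (-1 , 0 , -2)
        ; similitude = refl ; inverseˡ = refl ; inverseʳ = refl ; forward = refl ; backward = refl }
      even→U∧¬χ : Transfer 32 (diag 1 7 12) 12 Even (negate χ ∷ U)
      even→U∧¬χ = record
        { d = 4 ; e = 4
        ; L  = (-2 , 0 , -12) , (0 , -4 , 0) , (-1 , 0 , 2)
        ; L′ = (-2 , 0 , -12) , (0 , -4 , 0) , (-1 , 0 , 2)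
        ; similitude = refl ; inverseˡ = refl ; inverseʳ = refl ; forward = refl ; backward = refl }

    odd≡2even-1-7-28 : ∀ {M} → + M ≡ 12 [mod 32 ] →
      #Solutions (diag 1 7 28) M Odd ≡ 2 ℕ.* #Solutions (diag 1 7 28) M Even
    odd≡2even-1-7-28 M≡12 = split-double even→odd∧φ even→odd∧¬φ M≡12 (diag-bounded 1 7 28)
      where
      φ : Literal
      φ = ⟨ (-1 , -1 , 0) ≡ 0 mod 4 ⟩
      even→odd∧φ : Transfer 32 (diag 1 7 28) 12 Even (φ ∷ Odd)
      even→odd∧φ = record
        { d = 4 ; e = 8
        ; L  = (-3 , 0 , -14) , (-1 , 0 , 6) , (0 , 2 , 0)
        ; L′ = (-6 , -14 , 0) , (0 , 0 , 16) , (-1 , 3 , 0)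
        ; similitude = refl ; inverseˡ = refl ; inverseʳ = refl ; forward = refl ; backward = refl }
      even→odd∧¬φ : Transfer 32 (diag 1 7 28) 12 Even (negate φ ∷ Odd)
      even→odd∧¬φ = record
        { d = 4 ; e = 8
        ; L  = (-3 , 0 , -14) , (1 , 0 , -6) , (0 , 2 , 0)
        ; L′ = (-6 , 14 , 0) , (0 , 0 , 16) , (-1 , -3 , 0)
        ; similitude = refl ; inverseˡ = refl ; inverseʳ = refl ; forward = refl ; backward = refl }

    odd≡2even-3-4-21 : ∀ {M} → + M ≡ 4 [mod 32 ] →
      #Solutions (diag 3 4 21) M Odd ≡ 2 ℕ.* #Solutions (diag 3 4 21) M Even
    odd≡2even-3-4-21 M≡4 = trans
      (split-transfer odd∧φ→U∧ψ odd∧¬φ→U∧¬ψ M≡4 (diag-bounded 3 4 21))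
      (split-double even→U∧χ even→U∧¬χ M≡4 (diag-bounded 3 4 21))
      where
      φ ψ χ : Literal
      φ = ⟨ (1 , 0 , 1) ≡ 0 mod 4 ⟩
      ψ = ⟨ (-1 , 0 , -1) ≡ 0 mod 8 ⟩
      χ = ⟨ (-1 , -2 , 0) ≡ 0 mod 8 ⟩
      U : List Literal
      U = ⟨ (1 , 0 , 0) ≡ 2 mod 4 ⟩ ∷ ⟨ (0 , 1 , 0) ≡ 1 mod 2 ⟩ ∷ ⟨ (0 , 0 , 1) ≡ 2 mod 4 ⟩ ∷ []
      odd∧φ→U∧ψ : Transfer 32 (diag 3 4 21) 4 (φ ∷ Odd) (ψ ∷ U)
      odd∧φ→U∧ψ = record
        { d = 4 ; e = 4
        ; L  = (-3 , 0 , -7) , (0 , -4 , 0) , (1 , 0 , -3)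
        ; L′ = (-3 , 0 , 7) , (0 , -4 , 0) , (-1 , 0 , -3)
        ; similitude = refl ; inverseˡ = refl ; inverseʳ = refl ; forward = refl ; backward = refl }
      odd∧¬φ→U∧¬ψ : Transfer 32 (diag 3 4 21) 4 (negate φ ∷ Odd) (negate ψ ∷ U)
      odd∧¬φ→U∧¬ψ = record
        { d = 4 ; e = 4
        ; L  = (-3 , 0 , 7) , (0 , -4 , 0) , (-1 , 0 , -3)
        ; L′ = (-3 , 0 , -7) , (0 , -4 , 0) , (1 , 0 , -3)
        ; similitude = refl ; inverseˡ = refl ; inverseʳ = refl ; forward = refl ; backward = refl }
      even→U∧χ : Transfer 32 (diag 3 4 21) 4 Even (χ ∷ U)
      even→U∧χ = record
        { d = 4 ; e = 4
        ; L  = (-2 , -4 , 0) , (-3 , 2 , 0) , (0 , 0 , 4)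
        ; L′ = (-2 , -4 , 0) , (-3 , 2 , 0) , (0 , 0 , 4)
        ; similitude = refl ; inverseˡ = refl ; inverseʳ = refl ; forward = refl ; backward = refl }
      even→U∧¬χ : Transfer 32 (diag 3 4 21) 4 Even (negate χ ∷ U)
      even→U∧¬χ = record
        { d = 4 ; e = 4
        ; L  = (-2 , -4 , 0) , (3 , -2 , 0) , (0 , 0 , 4)
        ; L′ = (-2 , 4 , 0) , (-3 , -2 , 0) , (0 , 0 , 4)
        ; similitude = refl ; inverseˡ = refl ; inverseʳ = refl ; forward = refl ; backward = refl }

    odd≡2even-3-21-28 : ∀ {M} → + M ≡ 28 [mod 32 ] →
      #Solutions (diag 3 21 28) M Odd ≡ 2 ℕ.* #Solutions (diag 3 21 28) M Even
    odd≡2even-3-21-28 M≡28 = trans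
      (split-transfer odd∧φ→U∧ψ odd∧¬φ→U∧¬ψ M≡28 (diag-bounded 3 21 28))
      (split-double even→U∧χ even→U∧¬χ M≡28 (diag-bounded 3 21 28))
      where
      φ ψ χ : Literal
      φ = ⟨ (1 , 1 , 0) ≡ 0 mod 4 ⟩
      ψ = ⟨ (-1 , -1 , 0) ≡ 4 mod 8 ⟩
      χ = ⟨ (0 , -1 , -2) ≡ 4 mod 8 ⟩
      U : List Literal
      U = ⟨ (1 , 0 , 0) ≡ 2 mod 4 ⟩ ∷ ⟨ (0 , 1 , 0) ≡ 2 mod 4 ⟩ ∷ ⟨ (0 , 0 , 1) ≡ 1 mod 2 ⟩ ∷ []
      odd∧φ→U∧ψ : Transfer 32 (diag 3 21 28) 28 (φ ∷ Odd) (ψ ∷ U)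
      odd∧φ→U∧ψ = record
        { d = 4 ; e = 4
        ; L  = (-3 , -7 , 0) , (-1 , 3 , 0) , (0 , 0 , 4)
        ; L′ = (-3 , -7 , 0) , (-1 , 3 , 0) , (0 , 0 , 4)
        ; similitude = refl ; inverseˡ = refl ; inverseʳ = refl ; forward = refl ; backward = refl }
      odd∧¬φ→U∧¬ψ : Transfer 32 (diag 3 21 28) 28 (negate φ ∷ Odd) (negate ψ ∷ U)
      odd∧¬φ→U∧¬ψ = record
        { d = 4 ; e = 4
        ; L  = (-3 , 7 , 0) , (1 , 3 , 0) , (0 , 0 , 4)
        ; L′ = (-3 , 7 , 0) , (1 , 3 , 0) , (0 , 0 , 4)
        ; similitude = refl ; inverseˡ = refl ; inverseʳ = refl ; forward = refl ; backward = refl }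
      even→U∧χ : Transfer 32 (diag 3 21 28) 28 Even (χ ∷ U)
      even→U∧χ = record
        { d = 4 ; e = 4
        ; L  = (-4 , 0 , 0) , (0 , -2 , -4) , (0 , 3 , -2)
        ; L′ = (-4 , 0 , 0) , (0 , -2 , 4) , (0 , -3 , -2)
        ; similitude = refl ; inverseˡ = refl ; inverseʳ = refl ; forward = refl ; backward = refl }
      even→U∧¬χ : Transfer 32 (diag 3 21 28) 28 Even (negate χ ∷ U)
      even→U∧¬χ = record
        { d = 4 ; e = 4
        ; L  = (-4 , 0 , 0) , (0 , -2 , -4) , (0 , -3 , 2)
        ; L′ = (-4 , 0 , 0) , (0 , -2 , -4) , (0 , -3 , 2)
        ; similitude = refl ; inverseˡ = refl ; inverseʳ = refl ; forward = refl ; backward = refl }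

open import Data.Nat using (ℕ; _+_; _*_; _%_)
open import Data.Product using (_×_; _,_)
open import Relation.Binary.PropositionalEquality using (_≡_; refl)

theorem5p1 : (n : ℕ) → 1 Data.Nat.≤ n →
    (n % 4 ≡ 1 → t 1 4 7 n ≡ 2 * N 1 4 7 (2 * n + 3))
    × (n % 4 ≡ 3 → t 1 7 12 n ≡ 2 * N 1 7 12 (2 * n + 5))
    × (n % 4 ≡ 1 → t 1 7 28 n ≡ 2 * N 1 7 28 (2 * n + 9))
    × (n % 4 ≡ 1 → t 3 4 21 n ≡ 2 * N 3 4 21 (2 * n + 7))
    × (n % 4 ≡ 1 → t 3 21 28 n ≡ 2 * N 3 21 28 (2 * n + 13))
theorem5p1 n _ =
    (λ n≡1 → t≡2N 1 4 7 3 n refl (odd≡2even-1-4-7 (4[2n+k]-mod-32 n 1 3 n≡1)))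
  , (λ n≡3 → t≡2N 1 7 12 5 n refl (odd≡2even-1-7-12 (4[2n+k]-mod-32 n 3 5 n≡3)))
  , (λ n≡1 → t≡2N 1 7 28 9 n refl (odd≡2even-1-7-28 (4[2n+k]-mod-32 n 1 9 n≡1)))
  , (λ n≡1 → t≡2N 3 4 21 7 n refl (odd≡2even-3-4-21 (4[2n+k]-mod-32 n 1 7 n≡1)))
  , (λ n≡1 → t≡2N 3 21 28 13 n refl (odd≡2even-3-21-28 (4[2n+k]-mod-32 n 1 13 n≡1)))
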